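{- Let $G$ be the graph with vertex set $\{a_1,b_1,c_1,d_1\}\cup\{a_2,b_2,c_2,d_2\}\cup\{a_3,b_3,c_3,d_3\}$ whose edges are exactly those making $\{a_1,b_1,c_1,d_1\}$ a clique and making each of $\{a_1,a_2,a_3\}$, $\{b_1,b_2,b_3\}$, $\{c_1,c_2,c_3\}$, $\{d_1,d_2,d_3\}$ a triangle. Then in any total tessellation cover of $G$ with four labels, the edges of three of these four triangles form tiles of one and the same tessellation, and the edges of the remaining triangle form a tile of a different tessellation.
   Context: A tessellation of a graph $G=(V,E)$ is a partition of $V$ into cliques (called tiles); an edge belongs to the tessellation if both its endpoints lie in the same tile. With $\Sigma=\{1,\dots,k\}$, a $k$-tessellation cover is a map $h$ assigning to each edge a nonempty subset of $\Sigma$ such that for each label $i$ the edges whose subset contains $i$ are exactly the edges of a tessellation (the tessellation with label $i$). A total tessellation cover of $G$ with $k$ labels is a pair $(f,h)$ where $f:V\to\Sigma$ is a proper vertex coloring and $h$ is a $k$-tessellation cover with labels in $\Sigma$, such that every edge $uv$ satisfies $f(u)\notin h(uv)$ and $f(v)\notin h(uv)$. -}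

module Defs where

open import Data.Nat using (ℕ)
open import Data.Fin using (Fin; zero; suc)
open import Data.Fin.Subset using (Subset; _∈_; _∉_; Nonempty)
open import Data.Product using (Σ; _×_; _,_; proj₁; proj₂)
open import Data.Sum using (_⊎_)
open import Relation.Binary.PropositionalEquality using (_≡_; _≢_)
open import Function.Bundles using (_⇔_)

-- The partition is
-- encoded by a labelling of the vertices with tile-names: the tiles are
-- the (nonempty) fibres of `tile`.
IsTessellation : {V : Set} → (V → V → Set) → (V → ℕ) → Set
IsTessellation {V} Adj tile = ∀ (u v : V) → tile u ≡ tile v → u ≢ v → Adj u v

IsTile : {V : Set} → (V → ℕ) → (V → Set) → Set
IsTile {V} tile S = Σ V λ u → ∀ (w : V) → (tile w ≡ tile u) ⇔ S w

-- A total tessellation cover with k labels (Σ = Fin k):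
--   f     : proper vertex colouring,
--   h     : assigns to every edge uv a nonempty set of labels,
--   tile i: the tessellation with label i; an edge carries label i iff
--           both its endpoints lie in the same tile of tessellation i,
--   and f(u), f(v) ∉ h(uv) for every edge uv.
-- (h is a function on ordered pairs; only its values on edges matter, and
--  on edges `cover` forces h u v and h v u to agree.)
record TotalTessellationCover {V : Set} (Adj : V → V → Set) (k : ℕ) : Set where
  field
    f        : V → Fin k
    h        : V → V → Subset k
    tile     : Fin k → V → ℕ
    proper   : ∀ u v → Adj u v → f u ≢ f v
    tess     : ∀ i → IsTessellation Adj (tile i)
    cover    : ∀ u v → Adj u v → ∀ i → (i ∈ h u v) ⇔ (tile i u ≡ tile i v)
    nonempty : ∀ u v → Adj u v → Nonempty (h u v)
    total    : ∀ u v → Adj u v → (f u ∉ h u v) × (f v ∉ h u v)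

open TotalTessellationCover public

-- The specific graph G.
-- Vertices are pairs (x , j) with letter x ∈ Fin 4 (0,1,2,3 = a,b,c,d)
-- and layer j ∈ Fin 3 (0,1,2 = subscripts 1,2,3); e.g. (0 , 1) = a₂.

GV : Set
GV = Fin 4 × Fin 3

layer1 layer2 layer3 : Fin 3
layer1 = zero
layer2 = suc zero
layer3 = suc (suc zero)

GAdj : GV → GV → Set
GAdj (x , j) (y , l) =
  (j ≡ layer1 × l ≡ layer1 × x ≢ y) ⊎ (x ≡ y × j ≢ l)

Triangle : Fin 4 → GV → Set
Triangle x w = w ≡ (x , layer1) ⊎ w ≡ (x , layer2) ⊎ w ≡ (x , layer3)

-- If the spokes x₁x₂ and x₁x₃ of triangle x carried labels l ≢ l′, every clique
-- edge at x₁ would carry a label avoiding colour x₁, l and l′.  For one such label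
-- n, the clique edge from x₁ to the vertex coloured n (the colouring is a bijection
-- on the clique) would also have to avoid n: a fifth value in Fin 4.  So each
-- triangle x has a common spoke label κ x, and the triangle is a tile of
-- tessellation κ x.  A clique edge x₁y₁ has a label avoiding the colours of x₁, y₁
-- and the labels κ x, κ y, so these four are not distinct; for g = colour⁻¹ ∘ κ
-- this says that g has no fixed point and, for x ≢ y, g x = g y or g x = y or
-- g y = x.  A finite check shows that such g is constant off a single point.
module Submission where

open import Defs
open import Data.Nat using (ℕ; suc; _≤_)
open import Data.Nat.Properties using (1+n≰n)
open import Data.Fin using (Fin; zero; suc; punchOut)
open import Data.Fin.Properties using (_≟_; all?; any?; injective⇒≤; punchOut-injective)
open import Data.Product using (Σ; ∃; ∃₂; _×_; _,_; proj₁; proj₂)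
open import Data.Sum using (_⊎_; inj₁; inj₂)
open import Data.Unit using (tt)
open import Data.Empty using (⊥-elim)
open import Data.Vec using (Vec; []; _∷_; lookup; tabulate)
open import Data.Vec.Properties using (lookup∘tabulate)
open import Data.Vec.Relation.Unary.All using (All; []; _∷_)
open import Data.Vec.Relation.Unary.Unique.Propositional using (Unique; []; _∷_)
open import Data.Vec.Relation.Unary.Unique.Propositional.Properties using (lookup-injective)
open import Function using (id; _∘_)
open import Function.Definitions using (Injective)
open import Function.Bundles using (mk⇔; Equivalence)
open import Relation.Nullary using (¬_; ¬?; yes; no; contradiction)
open import Relation.Nullary.Decidable using (toWitness; _→-dec_; _⊎-dec_; _×-dec_)
open import Relation.Binary.PropositionalEquality
  using (_≡_; _≢_; _≗_; refl; sym; trans; cong; subst; ≢-sym)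

unique⇒length≤ : ∀ {m n} {xs : Vec (Fin n) m} → Unique xs → m ≤ n
unique⇒length≤ u = injective⇒≤ (λ {i} {j} → lookup-injective u i j)

no-five-distinct : {a b c d e : Fin 4} → ¬ Unique (a ∷ b ∷ c ∷ d ∷ e ∷ [])
no-five-distinct u = 1+n≰n (unique⇒length≤ u)

injective⇒surjective : ∀ {n} {f : Fin n → Fin n} → Injective _≡_ _≡_ f →
                       ∀ c → ∃ λ i → f i ≡ c
injective⇒surjective {suc n} {f} f-injective c with any? (λ i → f i ≟ c)
... | yes hit = hit
... | no miss = contradiction (injective⇒≤ punched-injective) 1+n≰n
  where
  c≢f : ∀ i → c ≢ f i
  c≢f i c≡fi = miss (i , sym c≡fi)

  punched-injective : Injective _≡_ _≡_ (λ i → punchOut (c≢f i))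
  punched-injective {i} {j} = f-injective ∘ punchOut-injective (c≢f i) (c≢f j)

Compatible : ∀ {n} → (F κ : Fin n → Fin n) → Set
Compatible F κ = ∀ x y → x ≢ y → κ x ≡ κ y ⊎ κ x ≡ F y ⊎ κ y ≡ F x

AlmostConstant : ∀ {n} → (Fin n → Fin n) → Set
AlmostConstant g = ∃₂ λ x a → (∀ y → y ≢ x → g y ≡ a) × g x ≢ a

Compatible-resp : ∀ {n} {F κ κ′ : Fin n → Fin n} → κ ≗ κ′ → Compatible F κ → Compatible F κ′
Compatible-resp κ≗κ′ compat x y x≢y
  rewrite sym (κ≗κ′ x) | sym (κ≗κ′ y) = compat x y x≢y

AlmostConstant-resp : ∀ {n} {g g′ : Fin n → Fin n} → g ≗ g′ → AlmostConstant g → AlmostConstant g′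
AlmostConstant-resp g≗g′ (x , a , g≡a , gx≢a) =
  x , a , (λ y y≢x → trans (sym (g≗g′ y)) (g≡a y y≢x)) , (λ g′x≡a → gx≢a (trans (g≗g′ x) g′x≡a))

almost-constant : (g : Fin 4 → Fin 4) → (∀ x → g x ≢ x) → Compatible id g → AlmostConstant g
almost-constant g no-fix compat =
  AlmostConstant-resp g′≗g
    (tabulated (g zero) (g (suc zero)) (g (suc (suc zero))) (g (suc (suc (suc zero))))
      (λ x g′x≡x → no-fix x (trans (sym (g′≗g x)) g′x≡x))
      (Compatible-resp (sym ∘ g′≗g) compat))
  where
  -- the check runs over the four values of g, and g is only pointwise equal to
  -- the lookup of its tabulation
  g′≗g : lookup (tabulate g) ≗ g
  g′≗g = lookup∘tabulate g

  tabulated : ∀ a b c d → let g′ = lookup (a ∷ b ∷ c ∷ d ∷ []) in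
              (∀ x → g′ x ≢ x) → Compatible id g′ → AlmostConstant g′
  tabulated = toWitness {a? = all? λ a → all? λ b → all? λ c → all? λ d →
    let g′ = lookup (a ∷ b ∷ c ∷ d ∷ []) in
    all? (λ x → ¬? (g′ x ≟ x)) →-dec
    all? (λ x → all? λ y → ¬? (x ≟ y) →-dec ((g′ x ≟ g′ y) ⊎-dec (g′ x ≟ y) ⊎-dec (g′ y ≟ x))) →-dec
    any? (λ x → any? λ a → all? (λ y → ¬? (y ≟ x) →-dec (g′ y ≟ a)) ×-dec ¬? (g′ x ≟ a))} tt

almost-constant-relative : {F κ : Fin 4 → Fin 4} → Injective _≡_ _≡_ F →
                           (∀ x → κ x ≢ F x) → Compatible F κ → AlmostConstant κ
almost-constant-relative {F} {κ} F-injective κ≢F compat =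
  let x , a , g≡a , gx≢a = almost-constant g g-no-fix g-compat in
  x , F a , (λ y y≢x → trans (sym (F∘g y)) (cong F (g≡a y y≢x))) ,
  (λ κx≡Fa → gx≢a (F-injective (trans (F∘g x) κx≡Fa)))
  where
  F⁻¹ : Fin 4 → Fin 4
  F⁻¹ c = proj₁ (injective⇒surjective F-injective c)

  g : Fin 4 → Fin 4
  g = F⁻¹ ∘ κ

  F∘g : ∀ x → F (g x) ≡ κ x
  F∘g x = proj₂ (injective⇒surjective F-injective (κ x))

  g-no-fix : ∀ x → g x ≢ x
  g-no-fix x gx≡x = κ≢F x (trans (sym (F∘g x)) (cong F gx≡x))

  g-compat : Compatible id g
  g-compat x y x≢y with compat x y x≢y
  ... | inj₁ κx≡κy = inj₁ (F-injective (trans (F∘g x) (trans κx≡κy (sym (F∘g y)))))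
  ... | inj₂ (inj₁ κx≡Fy) = inj₂ (inj₁ (F-injective (trans (F∘g x) κx≡Fy)))
  ... | inj₂ (inj₂ κy≡Fx) = inj₂ (inj₂ (F-injective (trans (F∘g y) κy≡Fx)))

module _ {V : Set} {Adj : V → V → Set} {k : ℕ} (C : TotalTessellationCover Adj k) where

  SameTile : Fin k → V → V → Set
  SameTile i u v = tile C i u ≡ tile C i v

  edge-labelled : ∀ {u v} → Adj u v → ∃ λ i → SameTile i u v
  edge-labelled {u} {v} uv =
    let i , i∈h = nonempty C u v uv in i , Equivalence.to (cover C u v uv i) i∈h

  label≢colourˡ : ∀ {u v i} → Adj u v → SameTile i u v → i ≢ f C u
  label≢colourˡ {u} {v} {i} uv same refl =
    proj₁ (total C u v uv) (Equivalence.from (cover C u v uv i) same)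

  label≢colourʳ : ∀ {u v i} → Adj u v → SameTile i u v → i ≢ f C v
  label≢colourʳ {u} {v} {i} uv same refl =
    proj₂ (total C u v uv) (Equivalence.from (cover C u v uv i) same)

  common-label⇒adjacent : ∀ {u v w i} → SameTile i u v → SameTile i u w → v ≢ w → Adj v w
  common-label⇒adjacent {u} {v} {w} {i} uv uw = tess C i v w (trans (sym uv) uw)

_₁ _₂ _₃ : Fin 4 → GV
x ₁ = x , layer1
x ₂ = x , layer2
x ₃ = x , layer3

clique-edge : ∀ {x y} → x ≢ y → GAdj (x ₁) (y ₁)
clique-edge x≢y = inj₁ (refl , refl , x≢y)

spoke₂ : ∀ x → GAdj (x ₁) (x ₂)
spoke₂ x = inj₂ (refl , λ ())

spoke₃ : ∀ x → GAdj (x ₁) (x ₃)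
spoke₃ x = inj₂ (refl , λ ())

¬GAdj-off-clique : ∀ {x y j l} → x ≢ y → l ≢ layer1 → ¬ GAdj (x , j) (y , l)
¬GAdj-off-clique x≢y l≢1 (inj₁ (_ , l≡1 , _)) = l≢1 l≡1
¬GAdj-off-clique x≢y l≢1 (inj₂ (x≡y , _))     = x≢y x≡y

module _ (C : TotalTessellationCover GAdj 4) where

  colour : Fin 4 → Fin 4
  colour x = f C (x ₁)

  colour-injective : Injective _≡_ _≡_ colour
  colour-injective {x} {y} cx≡cy with x ≟ y
  ... | yes x≡y = x≡y
  ... | no x≢y  = contradiction cx≡cy (proper C _ _ (clique-edge x≢y))

  clique-label≢spoke-label : ∀ {x y l m i} → x ≢ y → l ≢ layer1 →
    SameTile C m (x ₁) (y ₁) → SameTile C i (x ₁) (x , l) → m ≢ i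
  clique-label≢spoke-label x≢y l≢1 x₁y₁ x₁xₗ refl =
    ¬GAdj-off-clique (≢-sym x≢y) l≢1
      (common-label⇒adjacent C x₁y₁ x₁xₗ (λ y₁≡xₗ → x≢y (sym (cong proj₁ y₁≡xₗ))))

  spokes-share-label : ∀ x → ∃ λ i → SameTile C i (x ₁) (x ₂) × SameTile C i (x ₁) (x ₃)
  spokes-share-label x with edge-labelled C (spoke₂ x) | edge-labelled C (spoke₃ x)
  ... | l , x₁x₂ | l′ , x₁x₃ with l ≟ l′
  ... | yes refl = l , x₁x₂ , x₁x₃
  ... | no l≢l′  = ⊥-elim (no-five-distinct
        ((n′≢n ∷ fresh x≢z x₁z₁) ∷ fresh x≢y x₁y₁ ∷
         (≢-sym l≢l′ ∷ label≢colourˡ C (spoke₃ x) x₁x₃ ∷ []) ∷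
         (label≢colourˡ C (spoke₂ x) x₁x₂ ∷ []) ∷ [] ∷ []))
    where
    fresh : ∀ {y m} → x ≢ y → SameTile C m (x ₁) (y ₁) → All (m ≢_) (l′ ∷ l ∷ colour x ∷ [])
    fresh x≢y x₁y₁ = clique-label≢spoke-label x≢y (λ ()) x₁y₁ x₁x₃ ∷
                     clique-label≢spoke-label x≢y (λ ()) x₁y₁ x₁x₂ ∷
                     label≢colourˡ C (clique-edge x≢y) x₁y₁ ∷ []

    preimage : ∀ c → ∃ λ z → colour z ≡ c
    preimage = injective⇒surjective colour-injective

    ≢colour⇒≢ : ∀ {c} → c ≢ colour x → x ≢ proj₁ (preimage c)
    ≢colour⇒≢ {c} c≢colour x≡z =
      c≢colour (trans (sym (proj₂ (preimage c))) (cong colour (sym x≡z)))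

    -- any y ≢ x would do; the preimage of l is one
    y : Fin 4
    y = proj₁ (preimage l)

    x≢y : x ≢ y
    x≢y = ≢colour⇒≢ (label≢colourˡ C (spoke₂ x) x₁x₂)

    n : Fin 4
    n = proj₁ (edge-labelled C (clique-edge x≢y))

    x₁y₁ : SameTile C n (x ₁) (y ₁)
    x₁y₁ = proj₂ (edge-labelled C (clique-edge x≢y))

    z : Fin 4
    z = proj₁ (preimage n)

    x≢z : x ≢ z
    x≢z = ≢colour⇒≢ (label≢colourˡ C (clique-edge x≢y) x₁y₁)

    n′ : Fin 4
    n′ = proj₁ (edge-labelled C (clique-edge x≢z))

    x₁z₁ : SameTile C n′ (x ₁) (z ₁)
    x₁z₁ = proj₂ (edge-labelled C (clique-edge x≢z))

    n′≢n : n′ ≢ n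
    n′≢n n′≡n = label≢colourʳ C (clique-edge x≢z) x₁z₁ (trans n′≡n (sym (proj₂ (preimage n))))

  spokes⇒triangle-tile : ∀ {x i} → SameTile C i (x ₁) (x ₂) → SameTile C i (x ₁) (x ₃) →
                         IsTile (tile C i) (Triangle x)
  spokes⇒triangle-tile {x} {i} x₁x₂ x₁x₃ = x ₁ , λ w → mk⇔ (to w) (from w)
    where
    to : ∀ w → tile C i w ≡ tile C i (x ₁) → Triangle x w
    to (y , j) w~x₁ with y ≟ x
    to (y , zero)             _ | yes refl = inj₁ refl
    to (y , suc zero)         _ | yes refl = inj₂ (inj₁ refl)
    to (y , suc (suc zero))   _ | yes refl = inj₂ (inj₂ refl)
    to (y , j)             w~x₁ | no y≢x   = contradiction
      (common-label⇒adjacent C (sym w~x₁) x₁x₂ (y≢x ∘ cong proj₁)) (¬GAdj-off-clique y≢x (λ ()))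

    from : ∀ w → Triangle x w → tile C i w ≡ tile C i (x ₁)
    from _ (inj₁ refl)        = refl
    from _ (inj₂ (inj₁ refl)) = sym x₁x₂
    from _ (inj₂ (inj₂ refl)) = sym x₁x₃

  triangleLabel : Fin 4 → Fin 4
  triangleLabel x = proj₁ (spokes-share-label x)

  triangleLabel-spoke₂ : ∀ x → SameTile C (triangleLabel x) (x ₁) (x ₂)
  triangleLabel-spoke₂ x = proj₁ (proj₂ (spokes-share-label x))

  triangle-tile : ∀ x → IsTile (tile C (triangleLabel x)) (Triangle x)
  triangle-tile x =
    spokes⇒triangle-tile (triangleLabel-spoke₂ x) (proj₂ (proj₂ (spokes-share-label x)))

  triangleLabel≢colour : ∀ x → triangleLabel x ≢ colour x
  triangleLabel≢colour x = label≢colourˡ C (spoke₂ x) (triangleLabel-spoke₂ x)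

  triangleLabel-compatible : Compatible colour triangleLabel
  triangleLabel-compatible x y x≢y
    with triangleLabel x ≟ triangleLabel y | triangleLabel x ≟ colour y | triangleLabel y ≟ colour x
  ... | yes κx≡κy | _ | _ = inj₁ κx≡κy
  ... | no _ | yes κx≡Fy | _ = inj₂ (inj₁ κx≡Fy)
  ... | no _ | no _ | yes κy≡Fx = inj₂ (inj₂ κy≡Fx)
  ... | no κx≢κy | no κx≢Fy | no κy≢Fx = ⊥-elim (no-five-distinct
        ((m≢κx ∷ m≢κy ∷ label≢colourˡ C xy x₁y₁ ∷ label≢colourʳ C xy x₁y₁ ∷ []) ∷
         (κx≢κy ∷ triangleLabel≢colour x ∷ κx≢Fy ∷ []) ∷
         (κy≢Fx ∷ triangleLabel≢colour y ∷ []) ∷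
         (proper C _ _ xy ∷ []) ∷ [] ∷ []))
    where
    xy : GAdj (x ₁) (y ₁)
    xy = clique-edge x≢y

    m : Fin 4
    m = proj₁ (edge-labelled C xy)

    x₁y₁ : SameTile C m (x ₁) (y ₁)
    x₁y₁ = proj₂ (edge-labelled C xy)

    m≢κx : m ≢ triangleLabel x
    m≢κx = clique-label≢spoke-label x≢y (λ ()) x₁y₁ (triangleLabel-spoke₂ x)

    m≢κy : m ≢ triangleLabel y
    m≢κy = clique-label≢spoke-label (≢-sym x≢y) (λ ()) (sym x₁y₁) (triangleLabel-spoke₂ y)

lemma3 : (C : TotalTessellationCover GAdj 4) →
    Σ (Fin 4) λ i → Σ (Fin 4) λ j → i ≢ j × Σ (Fin 4) λ x →
      ((y : Fin 4) → y ≢ x → IsTile (tile C i) (Triangle y))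
      × IsTile (tile C j) (Triangle x)
lemma3 C =
  let x , c , κy≡c , κx≢c = almost-constant-relative (colour-injective C)
                              (triangleLabel≢colour C) (triangleLabel-compatible C)
  in c , triangleLabel C x , ≢-sym κx≢c , x ,
     (λ y y≢x → subst (λ i → IsTile (tile C i) (Triangle y)) (κy≡c y y≢x) (triangle-tile C y)) ,
     triangle-tile C x
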